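{- Let $p$ be an odd prime, $n\ge1$, and let $M=Ap^n+w_n$ with integers $0<A<p^n$, $0<w_n<p^n$ and $w_n^{p-1}\equiv1\pmod{p^n}$. Let $f$ be the multiplicative order of $M$ modulo $p$ and let $\Phi_f(x)$ denote the $f$-th cyclotomic polynomial. Then $p^n\mid\Phi_f(M)$. -}

module Defs where

open import Data.Nat using (ℕ; zero; suc; _+_; _*_; _∸_; _^_; _<_; _/_)
open import Data.Nat.Divisibility using (_∣?_)
open import Data.List using (List; filter; upTo; map)
open import Data.Nat.ListAction using (product)
open import Data.Integer as ℤ using (ℤ; +_)
open import Data.Integer.Divisibility as ℤD using ()
open import Data.Product using (_×_)
open import Relation.Nullary using (¬_)

infix 4 _≡_[mod_]
_≡_[mod_] : ℕ → ℕ → ℕ → Set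
a ≡ b [mod m ] = (+ m) ℤD.∣ ((+ a) ℤ.- (+ b))

IsMultOrder : ℕ → ℕ → ℕ → Set
IsMultOrder p M f =
  0 < f × (M ^ f ≡ 1 [mod p ]) × (∀ g → 0 < g → g < f → ¬ (M ^ g ≡ 1 [mod p ]))

-- Division with the convention a / 0 = 0 (never used for x ≥ 2, see below).
_div_ : ℕ → ℕ → ℕ
a div zero = 0
a div suc k = a / suc k

properDivisors : ℕ → List ℕ
properDivisors n = filter (λ d → d ∣? n) (map suc (upTo (n ∸ 1)))

-- Value of the n-th cyclotomic polynomial at x, computed from the defining
-- identity  x^n - 1 = ∏_{d ∣ n} Φ_d(x),  i.e.
--   Φ_n(x) = (x^n - 1) / ∏_{d ∣ n, d < n} Φ_d(x),
-- by recursion with fuel (fuel n+1 suffices since divisors strictly decrease).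
-- For x ≥ 2 and n ≥ 1 every division here is exact with nonzero divisor, and
-- the result is exactly the integer Φ_n(x) (evaluation at x is a ring
-- homomorphism ℤ[X] → ℤ and Φ_n(x) > 0 for x ≥ 2).
cycloFuel : ℕ → ℕ → ℕ → ℕ
cycloFuel zero n x = 1
cycloFuel (suc k) n x =
  (x ^ n ∸ 1) div product (map (λ d → cycloFuel k d x) (properDivisors n))

cyclotomicAt : ℕ → ℕ → ℕ
cyclotomicAt n x = cycloFuel (suc n) n x

{-# OPTIONS --safe #-}
-- Write q = pⁿ and M = A q + w. Since M ≡ w (mod q) and p ∣ q, the order condition gives
-- p ∣ w^f − 1. Writing w^f = 1 + z, the hypothesis on w gives q ∣ (1 + z)^(p−1) − 1 =
-- z ((p − 1) + z c), whose second factor is prime to p as p ∣ z; so q ∣ z, i.e. q ∣ M^f − 1.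
-- Now M^f − 1 = Φ_f(M) ∏_{d ∣ f, d < f} Φ_d(M), and p divides no Φ_d(M) with d < f because
-- Φ_d(M) ∣ M^d − 1; hence q ∣ Φ_f(M).
-- The factorisation is proved for the values computed by cyclotomicAt, without polynomials:
-- ∏_{d ∣ N, d ≤ k} Φ_d(x) = lcm {x^d − 1 : d ∣ N, d ≤ k}, by induction on k, using
-- gcd (x^a − 1) (x^b − 1) ∣ x^gcd(a,b) − 1 and gcd (lcm a b) c ∣ lcm (gcd a c) (gcd b c).
module Submission where

open import Defs
open import Data.Nat
open import Data.Nat.Properties
open import Data.Nat.Divisibility
open import Data.Nat.DivMod using (m/n*n≡m)
open import Data.Nat.GCD
open import Data.Nat.LCM
open import Data.Nat.Primality using (Prime; euclidsLemma; prime⇒nonTrivial; prime⇒nonZero; ¬prime[1])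
open import Data.Nat.ListAction using (product)
open import Data.Nat.ListAction.Properties using (product-++)
open import Data.Nat.Tactic.RingSolver using (solve-∀)
open import Data.Integer as ℤ using ()
open import Data.Integer.Properties using (m-n≡m⊖n; ⊖-≥)
open import Data.List using (_++_; [_]; map; filter; upTo)
open import Data.List.Properties using (upTo-∷ʳ; map-++; filter-++)
open import Data.Product using (∃; _,_)
open import Data.Sum using (inj₁; inj₂)
open import Data.Empty using (⊥-elim)
open import Function.Bundles using (_⇔_; mk⇔; module Equivalence)
open import Relation.Binary.PropositionalEquality hiding ([_])
open import Relation.Nullary using (¬_; yes; no)

≡[mod]⇒∣∸ : ∀ {m a b} → b ≤ a → a ≡ b [mod m ] → m ∣ a ∸ b
≡[mod]⇒∣∸ {m} {a} {b} b≤a = subst (λ z → m ∣ ℤ.∣ z ∣) (trans (m-n≡m⊖n a b) (⊖-≥ b≤a))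

∣∸⇒≡[mod] : ∀ {m a b} → b ≤ a → m ∣ a ∸ b → a ≡ b [mod m ]
∣∸⇒≡[mod] {m} {a} {b} b≤a = subst (λ z → m ∣ ℤ.∣ z ∣) (sym (trans (m-n≡m⊖n a b) (⊖-≥ b≤a)))

m-div-n*n≡m : ∀ {m n} → 0 < n → n ∣ m → (m div n) * n ≡ m
m-div-n*n≡m {n = suc _} _ n∣m = m/n*n≡m n∣m

prime⇒p≥2 : ∀ {p} → Prime p → 2 ≤ p
prime⇒p≥2 {p} p-prime = nonTrivial⇒n>1 p {{prime⇒nonTrivial p-prime}}

prime∤1 : ∀ {p} → Prime p → ¬ p ∣ 1
prime∤1 p-prime p∣1 = ¬prime[1] (subst Prime (∣1⇒≡1 p∣1) p-prime)

module _ {x : ℕ} (x≥1 : 1 ≤ x) where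

  x^n≥1 : ∀ n → 1 ≤ x ^ n
  x^n≥1 = m^n>0 x {{>-nonZero x≥1}}

  x^[m+n]∸1≡x^n*[x^m∸1]+[x^n∸1] : ∀ m n → x ^ (m + n) ∸ 1 ≡ x ^ n * (x ^ m ∸ 1) + (x ^ n ∸ 1)
  x^[m+n]∸1≡x^n*[x^m∸1]+[x^n∸1] m n rewrite ^-distribˡ-+-* x m n
    with x ^ m | x^n≥1 m | x ^ n | x^n≥1 n
  ... | suc u | _ | suc v | _ = trans (+-comm v (u * suc v)) (cong (_+ v) (*-comm u (suc v)))

  x^m∸1∣x^[k*m]∸1 : ∀ m k → x ^ m ∸ 1 ∣ x ^ (k * m) ∸ 1
  x^m∸1∣x^[k*m]∸1 m zero = _ ∣0
  x^m∸1∣x^[k*m]∸1 m (suc k)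
    rewrite +-comm m (k * m) | x^[m+n]∸1≡x^n*[x^m∸1]+[x^n∸1] (k * m) m =
    ∣m∣n⇒∣m+n (∣n⇒∣m*n (x ^ m) (x^m∸1∣x^[k*m]∸1 m k)) ∣-refl

  ∣⇒x^m∸1∣x^n∸1 : ∀ {m n} → m ∣ n → x ^ m ∸ 1 ∣ x ^ n ∸ 1
  ∣⇒x^m∸1∣x^n∸1 {m} (divides k refl) = x^m∸1∣x^[k*m]∸1 m k

  ∣x^[m+n]∸1∧∣x^m∸1⇒∣x^n∸1 : ∀ {d} m n → d ∣ x ^ (m + n) ∸ 1 → d ∣ x ^ m ∸ 1 → d ∣ x ^ n ∸ 1
  ∣x^[m+n]∸1∧∣x^m∸1⇒∣x^n∸1 {d} m n d∣x^[m+n]∸1 d∣x^m∸1 =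
    ∣m+n∣m⇒∣n (subst (d ∣_) (x^[m+n]∸1≡x^n*[x^m∸1]+[x^n∸1] m n) d∣x^[m+n]∸1)
              (∣n⇒∣m*n (x ^ n) d∣x^m∸1)

  ∣x^m∸1∧∣x^n∸1⇒∣x^gcd[m,n]∸1 : ∀ {d} m n → d ∣ x ^ m ∸ 1 → d ∣ x ^ n ∸ 1 → d ∣ x ^ gcd m n ∸ 1
  ∣x^m∸1∧∣x^n∸1⇒∣x^gcd[m,n]∸1 {d} m n d∣x^m∸1 d∣x^n∸1 with Bézout.identity (gcd-GCD m n)
  ... | Bézout.+- u v g+vn≡um = ∣x^[m+n]∸1∧∣x^m∸1⇒∣x^n∸1 (v * n) (gcd m n)
          (subst (λ e → d ∣ x ^ e ∸ 1) (trans (sym g+vn≡um) (+-comm (gcd m n) (v * n)))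
                 (∣-trans d∣x^m∸1 (x^m∸1∣x^[k*m]∸1 m u)))
          (∣-trans d∣x^n∸1 (x^m∸1∣x^[k*m]∸1 n v))
  ... | Bézout.-+ u v g+um≡vn = ∣x^[m+n]∸1∧∣x^m∸1⇒∣x^n∸1 (u * m) (gcd m n)
          (subst (λ e → d ∣ x ^ e ∸ 1) (trans (sym g+um≡vn) (+-comm (gcd m n) (u * m)))
                 (∣-trans d∣x^n∸1 (x^m∸1∣x^[k*m]∸1 n v)))
          (∣-trans d∣x^m∸1 (x^m∸1∣x^[k*m]∸1 m u))

x^[1+n]∸1>0 : ∀ {x} → 2 ≤ x → ∀ n → 0 < x ^ suc n ∸ 1
x^[1+n]∸1>0 x≥2 n = m<n⇒0<n∸m (*-mono-≤ x≥2 (x^n≥1 (<⇒≤ x≥2) n))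

lcm-identityʳ : ∀ m → lcm m 1 ≡ m
lcm-identityʳ m = ∣-antisym (lcm-least ∣-refl (1∣ m)) (m∣lcm[m,n] m 1)

lcm>0 : ∀ {m n} → 0 < m → 0 < n → 0 < lcm m n
lcm>0 {m} {n} m>0 n>0 = n≢0⇒n>0 λ lcm≡0 → <⇒≢ (*-mono-< m>0 n>0)
  (sym (trans (sym (gcd*lcm m n)) (trans (cong (gcd m n *_) lcm≡0) (*-zeroʳ (gcd m n)))))

-- Multiply both sides by h = gcd (gcd a c) (gcd b c): the right side becomes gcd a c * gcd b c,
-- the gcd of b * a, b * c, c * a and c * c, each of which gcd (lcm a b) c * h divides.
gcd[lcm[a,b],c]∣lcm[gcd[a,c],gcd[b,c]] : ∀ a b c .{{_ : NonZero c}} →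
  gcd (lcm a b) c ∣ lcm (gcd a c) (gcd b c)
gcd[lcm[a,b],c]∣lcm[gcd[a,c],gcd[b,c]] a b c = *-cancelʳ-∣ h {{h≢0}} u*h∣lcm*h
  where
  a′ = gcd a c
  b′ = gcd b c
  h = gcd a′ b′
  u = gcd (lcm a b) c
  h≢0 : NonZero h
  h≢0 = ≢-nonZero (λ h≡0 → ≢-nonZero⁻¹ c (gcd[m,n]≡0⇒n≡0 a (gcd[m,n]≡0⇒m≡0 h≡0)))
  h∣a : h ∣ a
  h∣a = ∣-trans (gcd[m,n]∣m a′ b′) (gcd[m,n]∣m a c)
  h∣b : h ∣ b
  h∣b = ∣-trans (gcd[m,n]∣n a′ b′) (gcd[m,n]∣m b c)
  h∣c : h ∣ c
  h∣c = ∣-trans (gcd[m,n]∣m a′ b′) (gcd[m,n]∣n a c)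
  u∣c : u ∣ c
  u∣c = gcd[m,n]∣n (lcm a b) c
  u*h∣b*a : u * h ∣ b * a
  u*h∣b*a = subst (u * h ∣_) (trans (*-comm (lcm a b) (gcd a b)) (trans (gcd*lcm a b) (*-comm a b)))
    (*-pres-∣ (gcd[m,n]∣m (lcm a b) c) (gcd-greatest h∣a h∣b))
  a′*b′≡gcd : a′ * b′ ≡ gcd (gcd (b * a) (b * c)) (gcd (c * a) (c * c))
  a′*b′≡gcd = begin
    a′ * b′                                          ≡⟨ c*gcd[m,n]≡gcd[cm,cn] a′ b c ⟩
    gcd (a′ * b) (a′ * c)                            ≡⟨ cong₂ gcd (*-comm a′ b) (*-comm a′ c) ⟩
    gcd (b * a′) (c * a′)                            ≡⟨ cong₂ gcd (c*gcd[m,n]≡gcd[cm,cn] b a c)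
                                                                  (c*gcd[m,n]≡gcd[cm,cn] c a c) ⟩
    gcd (gcd (b * a) (b * c)) (gcd (c * a) (c * c))  ∎
    where open ≡-Reasoning
  u*h∣lcm*h : u * h ∣ lcm a′ b′ * h
  u*h∣lcm*h = subst (u * h ∣_)
    (trans (sym a′*b′≡gcd) (trans (sym (gcd*lcm a′ b′)) (*-comm h (lcm a′ b′))))
    (gcd-greatest (gcd-greatest u*h∣b*a (subst (u * h ∣_) (*-comm c b) (*-pres-∣ u∣c h∣b)))
                  (gcd-greatest (*-pres-∣ u∣c h∣a) (*-pres-∣ u∣c h∣c)))

restrictToDivisors : (ℕ → ℕ) → ℕ → ℕ → ℕ
restrictToDivisors g N j with j ∣? N
... | yes _ = g j
... | no  _ = 1

restrictToDivisors-elim : ∀ (P : ℕ → Set) {g N j} → P 1 → (j ∣ N → P (g j)) →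
  P (restrictToDivisors g N j)
restrictToDivisors-elim P {g} {N} {j} P1 Pg with j ∣? N
... | yes j∣N = Pg j∣N
... | no  _   = P1

divisorProduct : (ℕ → ℕ) → ℕ → ℕ → ℕ
divisorProduct g N zero    = 1
divisorProduct g N (suc k) = divisorProduct g N k * restrictToDivisors g N (suc k)

divisorLcm : (ℕ → ℕ) → ℕ → ℕ → ℕ
divisorLcm g N zero    = 1
divisorLcm g N (suc k) = lcm (divisorLcm g N k) (restrictToDivisors g N (suc k))

product-filter-divisors≡divisorProduct : ∀ g N k →
  product (map g (filter (_∣? N) (map suc (upTo k)))) ≡ divisorProduct g N k
product-filter-divisors≡divisorProduct g N zero = refl
product-filter-divisors≡divisorProduct g N (suc k) = begin
  product (map g (filter (_∣? N) (map suc (upTo (suc k)))))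
    ≡⟨ cong (λ l → product (map g (filter (_∣? N) (map suc l)))) (sym (upTo-∷ʳ k)) ⟩
  product (map g (filter (_∣? N) (map suc (upTo k ++ [ k ]))))
    ≡⟨ cong (λ l → product (map g (filter (_∣? N) l))) (map-++ suc (upTo k) [ k ]) ⟩
  product (map g (filter (_∣? N) (ds ++ [ suc k ])))
    ≡⟨ cong (λ l → product (map g l)) (filter-++ (_∣? N) ds [ suc k ]) ⟩
  product (map g (filter (_∣? N) ds ++ filter (_∣? N) [ suc k ]))
    ≡⟨ cong product (map-++ g (filter (_∣? N) ds) (filter (_∣? N) [ suc k ])) ⟩
  product (map g (filter (_∣? N) ds) ++ map g (filter (_∣? N) [ suc k ]))
    ≡⟨ product-++ (map g (filter (_∣? N) ds)) (map g (filter (_∣? N) [ suc k ])) ⟩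
  product (map g (filter (_∣? N) ds)) * product (map g (filter (_∣? N) [ suc k ]))
    ≡⟨ cong₂ _*_ (product-filter-divisors≡divisorProduct g N k) (last (suc k)) ⟩
  divisorProduct g N k * restrictToDivisors g N (suc k) ∎
  where
  open ≡-Reasoning
  ds = map suc (upTo k)
  last : ∀ j → product (map g (filter (_∣? N) [ j ])) ≡ restrictToDivisors g N j
  last j with j ∣? N
  ... | yes _ = *-identityʳ (g j)
  ... | no  _ = refl

divisorProduct-cong : ∀ {g h} N k → (∀ {d} → 1 ≤ d → d ≤ k → g d ≡ h d) →
  divisorProduct g N k ≡ divisorProduct h N k
divisorProduct-cong N zero _ = refl
divisorProduct-cong {g} {h} N (suc k) g≗h =
  cong₂ _*_ (divisorProduct-cong N k (λ 1≤d d≤k → g≗h 1≤d (m≤n⇒m≤1+n d≤k))) last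
  where
  last : restrictToDivisors g N (suc k) ≡ restrictToDivisors h N (suc k)
  last with suc k ∣? N
  ... | yes _ = g≗h (s≤s z≤n) ≤-refl
  ... | no  _ = refl

prime∤divisorProduct : ∀ {p g N} → Prime p → ∀ k → (∀ {d} → 1 ≤ d → d ≤ k → d ∣ N → ¬ p ∣ g d) →
  ¬ p ∣ divisorProduct g N k
prime∤divisorProduct p-prime zero _ = prime∤1 p-prime
prime∤divisorProduct {p} p-prime (suc k) p∤g p∣∏ with euclidsLemma _ _ p-prime p∣∏
... | inj₁ p∣∏′ = prime∤divisorProduct p-prime k (λ 1≤d d≤k → p∤g 1≤d (m≤n⇒m≤1+n d≤k)) p∣∏′
... | inj₂ p∣last = restrictToDivisors-elim (λ r → ¬ p ∣ r)
  (prime∤1 p-prime) (p∤g (s≤s z≤n) ≤-refl) p∣last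

cycloFuel-unfold : ∀ k n x →
  cycloFuel (suc k) n x ≡ (x ^ n ∸ 1) div divisorProduct (λ d → cycloFuel k d x) n (n ∸ 1)
cycloFuel-unfold k n x =
  cong ((x ^ n ∸ 1) div_) (product-filter-divisors≡divisorProduct (λ d → cycloFuel k d x) n (n ∸ 1))

0<m≤n∸1⇒m<n : ∀ {m n} → 0 < m → m ≤ n ∸ 1 → m < n
0<m≤n∸1⇒m<n {n = zero}  (s≤s _) ()
0<m≤n∸1⇒m<n {n = suc _} _       m≤n = s≤s m≤n

cycloFuel-stable : ∀ x {k j} d → d < k → d < j → cycloFuel k d x ≡ cycloFuel j d x
cycloFuel-stable x {suc k} {suc j} d (s≤s d≤k) (s≤s d≤j) = begin
  cycloFuel (suc k) d x                                               ≡⟨ cycloFuel-unfold k d x ⟩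
  (x ^ d ∸ 1) div divisorProduct (λ e → cycloFuel k e x) d (d ∸ 1)
    ≡⟨ cong ((x ^ d ∸ 1) div_) (divisorProduct-cong d (d ∸ 1) (λ 0<e e≤d∸1 →
         let e<d = 0<m≤n∸1⇒m<n 0<e e≤d∸1 in
         cycloFuel-stable x _ (<-≤-trans e<d d≤k) (<-≤-trans e<d d≤j))) ⟩
  (x ^ d ∸ 1) div divisorProduct (λ e → cycloFuel j e x) d (d ∸ 1)    ≡⟨ cycloFuel-unfold j d x ⟨
  cycloFuel (suc j) d x                                               ∎
  where open ≡-Reasoning

cyclotomicAt-unfold : ∀ x d → cyclotomicAt (suc d) x ≡
  (x ^ suc d ∸ 1) div divisorProduct (λ e → cyclotomicAt e x) (suc d) d
cyclotomicAt-unfold x d = trans (cycloFuel-unfold (suc d) (suc d) x)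
  (cong ((x ^ suc d ∸ 1) div_) (divisorProduct-cong (suc d) d (λ _ e≤d →
    cycloFuel-stable x _ (s≤s e≤d) ≤-refl)))

module CyclotomicFactorisation {x : ℕ} (x≥2 : 2 ≤ x) where

  private
    x≥1 : 1 ≤ x
    x≥1 = <⇒≤ x≥2

    Φ : ℕ → ℕ
    Φ n = cyclotomicAt n x

    x^_∸1 : ℕ → ℕ
    x^ d ∸1 = x ^ d ∸ 1

    L : ℕ → ℕ → ℕ
    L = divisorLcm x^_∸1

  L>0 : ∀ N k → 0 < L N k
  L>0 N zero    = s≤s z≤n
  L>0 N (suc k) = lcm>0 (L>0 N k)
    (restrictToDivisors-elim (0 <_) {x^_∸1} {N} {suc k} (s≤s z≤n) (λ _ → x^[1+n]∸1>0 x≥2 k))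

  L∣x^N∸1 : ∀ N k → L N k ∣ x ^ N ∸ 1
  L∣x^N∸1 N zero    = 1∣ _
  L∣x^N∸1 N (suc k) = lcm-least (L∣x^N∸1 N k)
    (restrictToDivisors-elim (_∣ x ^ N ∸ 1) {x^_∸1} {N} {suc k} (1∣ _) (∣⇒x^m∸1∣x^n∸1 x≥1))

  x^d∸1∣L : ∀ {N d} k → 0 < d → d ≤ k → d ∣ N → x ^ d ∸ 1 ∣ L N k
  x^d∸1∣L zero (s≤s _) ()
  x^d∸1∣L {N} (suc k) 0<d d≤1+k d∣N with m≤n⇒m<n∨m≡n d≤1+k
  ... | inj₁ (s≤s d≤k) = ∣-trans (x^d∸1∣L k 0<d d≤k d∣N) (m∣lcm[m,n] (L N k) _)
  ... | inj₂ refl      = ∣-trans x^[1+k]∸1∣last (n∣lcm[m,n] (L N k) _)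
    where
    x^[1+k]∸1∣last : x ^ suc k ∸ 1 ∣ restrictToDivisors x^_∸1 N (suc k)
    x^[1+k]∸1∣last with suc k ∣? N
    ... | yes _    = ∣-refl
    ... | no  1+k∤N = ⊥-elim (1+k∤N d∣N)

  L-mono : ∀ {j N} → j ∣ N → ∀ k → L j k ∣ L N k
  L-mono j∣N zero    = ∣-refl
  L-mono {j} {N} j∣N (suc k) = lcm-least (∣-trans (L-mono j∣N k) (m∣lcm[m,n] (L N k) _))
    (restrictToDivisors-elim (_∣ L N (suc k)) {x^_∸1} {j} {suc k} (1∣ _) (λ 1+k∣j →
      x^d∸1∣L (suc k) (s≤s z≤n) ≤-refl (∣-trans 1+k∣j j∣N)))

  gcd[x^[1+i]∸1,x^j∸1]∣L : ∀ {i j} k → suc i ≤ k → gcd (x ^ suc i ∸ 1) (x ^ j ∸ 1) ∣ L j k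
  gcd[x^[1+i]∸1,x^j∸1]∣L {i} {j} k 1+i≤k =
    ∣-trans (∣x^m∸1∧∣x^n∸1⇒∣x^gcd[m,n]∸1 x≥1 (suc i) j (gcd[m,n]∣m (x ^ suc i ∸ 1) (x ^ j ∸ 1))
                                                 (gcd[m,n]∣n (x ^ suc i ∸ 1) (x ^ j ∸ 1)))
            (x^d∸1∣L k (n≢0⇒n>0 (gcd[m,n]≢0 (suc i) j (inj₁ λ ())))
                       (≤-trans (∣⇒≤ (gcd[m,n]∣m (suc i) j)) 1+i≤k) (gcd[m,n]∣n (suc i) j))

  gcd[L,x^[1+j]∸1]∣L : ∀ {j} N k → gcd (L N k) (x ^ suc j ∸ 1) ∣ L (suc j) k
  gcd[L,x^[1+j]∸1]∣L {j} N zero = ∣-reflexive (gcd-zeroˡ (x ^ suc j ∸ 1))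
  gcd[L,x^[1+j]∸1]∣L {j} N (suc k) =
    ∣-trans (gcd[lcm[a,b],c]∣lcm[gcd[a,c],gcd[b,c]] (L N k) _ _ {{>-nonZero (x^[1+n]∸1>0 x≥2 j)}})
      (lcm-least (∣-trans (gcd[L,x^[1+j]∸1]∣L N k) (m∣lcm[m,n] (L (suc j) k) _))
        (restrictToDivisors-elim (λ r → gcd r (x ^ suc j ∸ 1) ∣ L (suc j) (suc k)) {x^_∸1} {N} {suc k}
          (∣-trans (∣-reflexive (gcd-zeroˡ (x ^ suc j ∸ 1))) (1∣ _))
          (λ _ → gcd[x^[1+i]∸1,x^j∸1]∣L (suc k) ≤-refl)))

  gcd[L,x^[1+j]∸1]≡L : ∀ {j N} → suc j ∣ N → ∀ k → gcd (L N k) (x ^ suc j ∸ 1) ≡ L (suc j) k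
  gcd[L,x^[1+j]∸1]≡L {j} {N} 1+j∣N k =
    ∣-antisym (gcd[L,x^[1+j]∸1]∣L N k) (gcd-greatest (L-mono 1+j∣N k) (L∣x^N∸1 (suc j) k))

  Φ*L≡x^[1+d]∸1 : ∀ d → divisorProduct Φ (suc d) d ≡ L (suc d) d →
    Φ (suc d) * L (suc d) d ≡ x ^ suc d ∸ 1
  Φ*L≡x^[1+d]∸1 d ∏Φ≡L = begin
    Φ (suc d) * L (suc d) d                          ≡⟨ cong (_* L (suc d) d) Φ[1+d]≡ ⟩
    ((x ^ suc d ∸ 1) div L (suc d) d) * L (suc d) d  ≡⟨ m-div-n*n≡m (L>0 (suc d) d) (L∣x^N∸1 (suc d) d) ⟩
    x ^ suc d ∸ 1                                    ∎
    where
    open ≡-Reasoning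
    Φ[1+d]≡ : Φ (suc d) ≡ (x ^ suc d ∸ 1) div L (suc d) d
    Φ[1+d]≡ = trans (cyclotomicAt-unfold x d) (cong ((x ^ suc d ∸ 1) div_) ∏Φ≡L)

  divisorProduct-Φ≡L : ∀ k N → divisorProduct Φ N k ≡ L N k
  divisorProduct-Φ≡L zero N = refl
  divisorProduct-Φ≡L (suc k) N with suc k ∣? N
  ... | no _ = trans (*-identityʳ _) (trans (divisorProduct-Φ≡L k N) (sym (lcm-identityʳ (L N k))))
  ... | yes 1+k∣N = *-cancelʳ-≡ (P * Φ (suc k)) (lcm X C) Y {{>-nonZero (L>0 (suc k) k)}} (begin
    P * Φ (suc k) * Y    ≡⟨ *-assoc P (Φ (suc k)) Y ⟩
    P * (Φ (suc k) * Y)  ≡⟨ cong₂ _*_ (divisorProduct-Φ≡L k N)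
                                      (Φ*L≡x^[1+d]∸1 k (divisorProduct-Φ≡L k (suc k))) ⟩
    X * C                ≡⟨ gcd*lcm X C ⟨
    gcd X C * lcm X C    ≡⟨ cong (_* lcm X C) (gcd[L,x^[1+j]∸1]≡L 1+k∣N k) ⟩
    Y * lcm X C          ≡⟨ *-comm Y (lcm X C) ⟩
    lcm X C * Y          ∎)
    where
    open ≡-Reasoning
    P = divisorProduct Φ N k
    X = L N k
    Y = L (suc k) k
    C = x ^ suc k ∸ 1

  cyclotomic-factorisation : ∀ d → Φ (suc d) * divisorProduct Φ (suc d) d ≡ x ^ suc d ∸ 1
  cyclotomic-factorisation d = trans (cong (Φ (suc d) *_) ∏Φ≡L) (Φ*L≡x^[1+d]∸1 d ∏Φ≡L)
    where
    ∏Φ≡L : divisorProduct Φ (suc d) d ≡ L (suc d) d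
    ∏Φ≡L = divisorProduct-Φ≡L d (suc d)

  cyclotomicAt∣x^n∸1 : ∀ n → Φ n ∣ x ^ n ∸ 1
  cyclotomicAt∣x^n∸1 zero    = ∣-refl   -- both sides are 0 (0 div 1 and 1 ∸ 1)
  cyclotomicAt∣x^n∸1 (suc d) = subst (Φ (suc d) ∣_) (cyclotomic-factorisation d) (m∣m*n _)

n∤n∸1 : ∀ {n} → 2 ≤ n → ¬ n ∣ n ∸ 1
n∤n∸1 {suc (suc _)} _ n∣n∸1 = 1+n≰n (∣⇒≤ n∣n∸1)
n∤n∸1 {suc zero} (s≤s ())

p∤n∧p^k∣m*n⇒p^k∣m : ∀ {p n} → Prime p → ¬ p ∣ n → ∀ k {m} → p ^ k ∣ m * n → p ^ k ∣ m
p∤n∧p^k∣m*n⇒p^k∣m p-prime p∤n zero {m} _ = 1∣ m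
p∤n∧p^k∣m*n⇒p^k∣m {p} {n} p-prime p∤n (suc k) {m} p^[1+k]∣m*n
  with euclidsLemma m n p-prime (∣-trans (m∣m*n (p ^ k)) p^[1+k]∣m*n)
... | inj₂ p∣n = ⊥-elim (p∤n p∣n)
... | inj₁ (divides r refl) = subst (p * p ^ k ∣_) (*-comm p r) (*-monoʳ-∣ p p^k∣r)
  where
  p^k∣r : p ^ k ∣ r
  p^k∣r = p∤n∧p^k∣m*n⇒p^k∣m p-prime p∤n k
    (*-cancelˡ-∣ p {{prime⇒nonZero p-prime}}
      (subst (p * p ^ k ∣_) (trans (cong (_* n) (*-comm r p)) (*-assoc p r n)) p^[1+k]∣m*n))

[a*q+w]^k≡w^k+q*b : ∀ a q w k → ∃ λ b → (a * q + w) ^ k ≡ w ^ k + q * b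
[a*q+w]^k≡w^k+q*b a q w zero = 0 , cong suc (sym (*-zeroʳ q))
[a*q+w]^k≡w^k+q*b a q w (suc k) with [a*q+w]^k≡w^k+q*b a q w k
... | b , eq = a * w ^ k + a * q * b + w * b ,
               trans (cong ((a * q + w) *_) eq) (expand a q w (w ^ k) b)
  where
  expand : ∀ a q w v b → (a * q + w) * (v + q * b) ≡ w * v + q * (a * v + a * q * b + w * b)
  expand = solve-∀

∣[a*q+w]^k∸1⇔∣w^k∸1 : ∀ {d} a {q w} k → d ∣ q → 0 < w → d ∣ (a * q + w) ^ k ∸ 1 ⇔ d ∣ w ^ k ∸ 1
∣[a*q+w]^k∸1⇔∣w^k∸1 {d} a {q} {w} k d∣q w>0 with [a*q+w]^k≡w^k+q*b a q w k
... | b , eq = mk⇔ (λ d∣M → ∣m+n∣m⇒∣n (subst (d ∣_) eq′ d∣M) d∣q*b)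
                   (λ d∣w → subst (d ∣_) (sym eq′) (∣m∣n⇒∣m+n d∣q*b d∣w))
  where
  d∣q*b : d ∣ q * b
  d∣q*b = ∣m⇒∣m*n b d∣q
  eq′ : (a * q + w) ^ k ∸ 1 ≡ q * b + (w ^ k ∸ 1)
  eq′ = trans (cong (_∸ 1) eq) (trans (+-∸-comm (q * b) (x^n≥1 w>0 k)) (+-comm (w ^ k ∸ 1) (q * b)))

[1+z]^m≡1+z*[m+z*c] : ∀ z m → ∃ λ c → (1 + z) ^ m ≡ 1 + z * (m + z * c)
[1+z]^m≡1+z*[m+z*c] z zero = 0 , base z
  where
  base : ∀ z → 1 ≡ 1 + z * (0 + z * 0)
  base = solve-∀
[1+z]^m≡1+z*[m+z*c] z (suc m) with [1+z]^m≡1+z*[m+z*c] z m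
... | c , eq = c + m + z * c , trans (cong ((1 + z) *_) eq) (step z m c)
  where
  step : ∀ z m c → (1 + z) * (1 + z * (m + z * c)) ≡ 1 + z * ((1 + m) + z * (c + m + z * c))
  step = solve-∀

p∣z∧p∤m∧p^k∣[1+z]^m∸1⇒p^k∣z : ∀ {p z m} → Prime p → p ∣ z → ¬ p ∣ m → ∀ k →
  p ^ k ∣ (1 + z) ^ m ∸ 1 → p ^ k ∣ z
p∣z∧p∤m∧p^k∣[1+z]^m∸1⇒p^k∣z {p} {z} {m} p-prime p∣z p∤m k p^k∣ with [1+z]^m≡1+z*[m+z*c] z m
... | c , eq = p∤n∧p^k∣m*n⇒p^k∣m p-prime p∤m+zc k (subst (p ^ k ∣_) (cong (_∸ 1) eq) p^k∣)
  where
  p∤m+zc : ¬ p ∣ m + z * c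
  p∤m+zc p∣m+zc = p∤m (∣m+n∣m⇒∣n (subst (p ∣_) (+-comm m (z * c)) p∣m+zc) (∣m⇒∣m*n c p∣z))

p∣[a*p^n+w]^f∸1⇒p^n∣[a*p^n+w]^f∸1 : ∀ {p n a w} f → Prime p → 1 ≤ n → 0 < w →
  p ^ n ∣ w ^ (p ∸ 1) ∸ 1 → p ∣ (a * p ^ n + w) ^ f ∸ 1 → p ^ n ∣ (a * p ^ n + w) ^ f ∸ 1
p∣[a*p^n+w]^f∸1⇒p^n∣[a*p^n+w]^f∸1 {p} {suc n} {a} {w} f p-prime _ w>0 p^n∣w^[p-1]∸1 p∣M^f∸1 =
  Equivalence.from (∣[a*q+w]^k∸1⇔∣w^k∸1 a f ∣-refl w>0) q∣w^f∸1
  where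
  q = p ^ suc n
  p∣w^f∸1 : p ∣ w ^ f ∸ 1
  p∣w^f∸1 = Equivalence.to (∣[a*q+w]^k∸1⇔∣w^k∸1 a f (m∣m*n (p ^ n)) w>0) p∣M^f∸1
  [w^[p-1]]^f≡[w^f]^[p-1] : (w ^ (p ∸ 1)) ^ f ≡ (1 + (w ^ f ∸ 1)) ^ (p ∸ 1)
  [w^[p-1]]^f≡[w^f]^[p-1] = begin
    (w ^ (p ∸ 1)) ^ f          ≡⟨ ^-*-assoc w (p ∸ 1) f ⟩
    w ^ ((p ∸ 1) * f)          ≡⟨ cong (w ^_) (*-comm (p ∸ 1) f) ⟩
    w ^ (f * (p ∸ 1))          ≡⟨ ^-*-assoc w f (p ∸ 1) ⟨
    (w ^ f) ^ (p ∸ 1)          ≡⟨ cong (_^ (p ∸ 1)) (m+[n∸m]≡n (x^n≥1 w>0 f)) ⟨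
    (1 + (w ^ f ∸ 1)) ^ (p ∸ 1) ∎
    where open ≡-Reasoning
  q∣[w^f]^[p-1]∸1 : q ∣ (1 + (w ^ f ∸ 1)) ^ (p ∸ 1) ∸ 1
  q∣[w^f]^[p-1]∸1 = subst (λ y → q ∣ y ∸ 1) [w^[p-1]]^f≡[w^f]^[p-1]
    (∣-trans (subst (λ y → q ∣ y ∸ 1) (sym (^-identityʳ (w ^ (p ∸ 1)))) p^n∣w^[p-1]∸1)
             (∣⇒x^m∸1∣x^n∸1 (x^n≥1 w>0 (p ∸ 1)) (1∣ f)))
  q∣w^f∸1 : q ∣ w ^ f ∸ 1
  q∣w^f∸1 = p∣z∧p∤m∧p^k∣[1+z]^m∸1⇒p^k∣z p-prime p∣w^f∸1
    (n∤n∸1 (prime⇒p≥2 p-prime)) (suc n) q∣[w^f]^[p-1]∸1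

proposition3p1 : (p n A w : ℕ) → Prime p → ¬ (2 ∣ p) → 1 ≤ n
    → 0 < A → A < p ^ n → 0 < w → w < p ^ n
    → w ^ (p ∸ 1) ≡ 1 [mod p ^ n ]
    → (f : ℕ) → IsMultOrder p (A * p ^ n + w) f
    → p ^ n ∣ cyclotomicAt f (A * p ^ n + w)
proposition3p1 p n A w p-prime _ n≥1 A>0 _ w>0 _ w^[p-1]≡1 zero (() , _)
proposition3p1 p n A w p-prime _ n≥1 A>0 _ w>0 _ w^[p-1]≡1 (suc f) (_ , M^f≡1 , minimal) =
  p∤n∧p^k∣m*n⇒p^k∣m p-prime p∤∏ n (subst (p ^ n ∣_) (sym (cyclotomic-factorisation f)) p^n∣M^f∸1)
  where
  M = A * p ^ n + w
  M≥2 : 2 ≤ M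
  M≥2 = +-mono-≤ (*-mono-≤ A>0 (x^n≥1 (<⇒≤ (prime⇒p≥2 p-prime)) n)) w>0
  M≥1 : 1 ≤ M
  M≥1 = <⇒≤ M≥2
  open CyclotomicFactorisation M≥2 using (cyclotomic-factorisation; cyclotomicAt∣x^n∸1)
  p^n∣M^f∸1 : p ^ n ∣ M ^ suc f ∸ 1
  p^n∣M^f∸1 = p∣[a*p^n+w]^f∸1⇒p^n∣[a*p^n+w]^f∸1 {a = A} (suc f) p-prime n≥1 w>0
    (≡[mod]⇒∣∸ (x^n≥1 w>0 (p ∸ 1)) w^[p-1]≡1) (≡[mod]⇒∣∸ (x^n≥1 M≥1 (suc f)) M^f≡1)
  p∤∏ : ¬ p ∣ divisorProduct (λ d → cyclotomicAt d M) (suc f) f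
  p∤∏ = prime∤divisorProduct p-prime f λ {d} 0<d d≤f _ p∣Φ[d] →
    minimal d 0<d (s≤s d≤f) (∣∸⇒≡[mod] (x^n≥1 M≥1 d) (∣-trans p∣Φ[d] (cyclotomicAt∣x^n∸1 d)))
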